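{- Let $\lambda$ be a nonzero real number. For all $n,m\in \mathbb{N}$, \[ K_{n,\lambda}^{(m)} = \sum_{1\le k_1\le k_2 \le \cdots \le k_m \le n}\frac{(-1)^{k_1-1}}{k_1 k_2 \cdots k_{m}} \binom{\lambda-1}{k_1-1}, \] where the sum runs over all integer tuples $(k_1,\dots,k_m)$ with $1\le k_1\le\cdots\le k_m\le n$.
   Context: For real $x$ and integer $k\ge0$, $\binom{x}{k}=\frac{x(x-1)\cdots(x-k+1)}{k!}$. For a nonzero real $\mu$ and integer $m$, the degenerate polylogarithm is the power series $\mathrm{Li}_{m,\mu}(t)=\sum_{n=1}^\infty \frac{(-1)^{n-1}}{n^m}\binom{\mu-1}{n-1}t^n$ (equivalently $\sum_{n\ge1}\frac{(-\mu)^{n-1}(1)_{n,1/\mu}}{(n-1)!\,n^m}t^n$, where $(x)_{0,\mu}=1$, $(x)_{n,\mu}=x(x-\mu)\cdots(x-(n-1)\mu)$). For $m\ge1$, the numbers $K^{(m)}_{n,\lambda}$ ($n\ge1$) are defined by the formal power series identity \[ \frac{ -1}{1-t}\mathrm{Li}_{m,-\lambda}\left(\frac{ -t}{1-t}\right)=\sum_{n=1}^\infty K_{n,\lambda}^{(m)}\, t^n . \] -}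

module Defs where

open import Level using (Level)
open import Data.Nat as ℕ using (ℕ; zero; suc)
open import Data.Bool using (Bool; true; false; _∧_)
open import Data.List as List using (List; []; _∷_; foldr; map; concatMap; filterᵇ)
open import Data.Vec as Vec using (Vec; []; _∷_)
open import Data.Product using (proj₁)
open import Algebra.Apartness.Bundles using (HeytingField)

-- Everything is done over a Heyting field F (constructive model of a field
-- with an apartness relation; the constructive reals are the motivating
-- example).
module WithField {c ℓ₁ ℓ₂ : Level} (F : HeytingField c ℓ₁ ℓ₂) where
  open HeytingField F using (Carrier; _≈_; _#_; _+_; _*_; -_; _-_; 0#; 1#; #⇒invertible)

  ι : ℕ → Carrier
  ι zero    = 0#
  ι (suc n) = 1# + ι n

  CharZero : Set ℓ₂
  CharZero = ∀ j → ι (suc j) # 0#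

  Σ[_] : List Carrier → Carrier
  Σ[ xs ] = foldr _+_ 0# xs

  sumTo : ℕ → (ℕ → Carrier) → Carrier
  sumTo zero    f = f zero
  sumTo (suc n) f = sumTo n f + f (suc n)

  _^_ : Carrier → ℕ → Carrier
  x ^ zero  = 1#
  x ^ suc n = x * (x ^ n)

  sign : ℕ → Carrier
  sign n = (- 1#) ^ n

  falling : Carrier → ℕ → Carrier
  falling x zero    = 1#
  falling x (suc k) = falling x k * (x - ι k)

  Series : Set c
  Series = ℕ → Carrier

  _⊛_ : Series → Series → Series
  (f ⊛ g) n = sumTo n (λ i → f i * g (n ℕ.∸ i))

  _⊛^_ : Series → ℕ → Series
  (f ⊛^ zero) zero    = 1#
  (f ⊛^ zero) (suc n) = 0#
  f ⊛^ suc k = f ⊛ (f ⊛^ k)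

  negS : Series → Series
  negS f n = - f n

  tS : Series
  tS zero          = 0#
  tS (suc zero)    = 1#
  tS (suc (suc n)) = 0#

  geomS : Series
  geomS n = 1#

  -- composition f(g(t)), for g with zero constant term:
  -- [t^n] f(g(t)) = Σ_{j=0}^{n} f_j [t^n] g(t)^j
  _∘S_ : Series → Series → Series
  (f ∘S g) n = sumTo n (λ j → f j * (g ⊛^ j) n)

  module WithCharZero (char0 : CharZero) where

    invSuc : ℕ → Carrier
    invSuc j = proj₁ (#⇒invertible (char0 j))

    -- 1/k for k ≥ 1 (the value at k = 0 is never used)
    inv : ℕ → Carrier
    inv zero    = 0#
    inv (suc j) = invSuc j

    invFact : ℕ → Carrier
    invFact zero    = 1#
    invFact (suc k) = invFact k * invSuc k

    binom : Carrier → ℕ → Carrier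
    binom x k = falling x k * invFact k

    -- degenerate polylogarithm Li_{m,μ}(t)
    --   = Σ_{n≥1} (-1)^{n-1} / n^m * binom(μ-1, n-1) t^n
    Li : ℕ → Carrier → Series
    Li m μ zero    = 0#
    Li m μ (suc j) = sign j * (invSuc j ^ m) * binom (μ - 1#) j

    argS : Series
    argS = negS (tS ⊛ geomS)

    -- K^{(m)}_{n,λ} = [t^n] ( -1/(1-t) Li_{m,-λ}(-t/(1-t)) )
    K : ℕ → Carrier → ℕ → Carrier
    K m lam n = negS (geomS ⊛ (Li m (- lam) ∘S argS)) n

    tuples : (m n : ℕ) → List (Vec ℕ m)
    tuples zero    n = [] ∷ []
    tuples (suc m) n =
      concatMap (λ k → map (k ∷_) (tuples m n)) (List.map suc (List.upTo n))

    nondecreasing : ∀ {m} → Vec ℕ m → Bool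
    nondecreasing []           = true
    nondecreasing (x ∷ [])     = true
    nondecreasing (x ∷ y ∷ ks) = (x ℕ.≤ᵇ y) ∧ nondecreasing (y ∷ ks)

    invProd : ∀ {m} → Vec ℕ m → Carrier
    invProd []       = 1#
    invProd (k ∷ ks) = inv k * invProd ks

    -- summand (-1)^{k₁-1}/(k₁⋯k_m) binom(λ-1, k₁-1)
    -- (the empty tuple never occurs since m ≥ 1)
    summand : Carrier → ∀ {m} → Vec ℕ m → Carrier
    summand lam []           = 1#
    summand lam ks@(k₁ ∷ _) =
      sign (k₁ ℕ.∸ 1) * invProd ks * binom (lam - 1#) (k₁ ℕ.∸ 1)

    RHS : ℕ → Carrier → ℕ → Carrier
    RHS m lam n = Σ[ map (summand lam) (filterᵇ nondecreasing (tuples m n)) ]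

-- Both sides equal Σ_{j<n} binom(-λ-1, j) C(n, j+1) / (j+1)^m.
-- For K this is a coefficient computation: [t^p] (-t/(1-t))^j = (-1)^j C(p-1, j-1), and the
-- factor 1/(1-t) sums these over p ≤ n (hockey stick).  For the tuple sum, upper negation
-- binom(z+s, s) = (-1)^s binom(-z-1, s) and Vandermonde's identity give
-- (-1)^(k-1) binom(λ-1, k-1) = Σ_j C(k, j+1) binom(-λ-1, j); then the sum over
-- k ≤ k₂ ≤ ⋯ ≤ k_m ≤ n collapses, via C(k, j+1)/k = C(k-1, j)/(j+1) and the hockey stick,
-- to C(n, j+1)/(j+1)^m.
module Submission where

open import Defs
open import Level using (Level)
open import Algebra.Apartness.Bundles using (HeytingField; HeytingCommutativeRing)
open import Algebra.Bundles using (CommutativeRing)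
open import Algebra.Solver.Ring.AlmostCommutativeRing using (fromCommutativeRing; _-Raw-AlmostCommutative⟶_)
open import Data.Bool using (Bool; true; false; T; _∧_)
open import Data.Empty using (⊥-elim)
open import Data.Integer as ℤ using (ℤ; +_; -[1+_]; _⊖_; _◃_)
import Data.Integer.Properties as ℤ
open import Data.List using (List; []; _∷_; _++_; map; concatMap; filterᵇ; applyUpTo; upTo)
import Data.List.Properties as List
open import Data.Maybe using (Maybe; nothing; just)
open import Data.Nat as ℕ using (ℕ; zero; suc; _∸_; _≤_; _<_; _≤′_; ≤′-refl; ≤′-step; s≤s; z≤n; _≤ᵇ_)
import Data.Nat.Properties as ℕ
open import Data.Nat.Combinatorics using (_C_; nCk+nC[k+1]≡[n+1]C[k+1]; nCk≡nC[n∸k]; k>n⇒nCk≡0; nC1≡n)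
open import Data.Nat.Tactic.RingSolver using (solve-∀)
open import Data.Product using (proj₂)
open import Data.Sign as Sign using (Sign)
open import Data.Vec using (Vec; _∷_)
open import Relation.Nullary using (yes; no)
open import Relation.Binary.PropositionalEquality as ≡ using (_≡_; cong; cong₂)

module Binomial where
  open import Data.Nat using (_+_; _*_)

  [1+k]*[1+n]C[1+k]≡[1+n]*nCk : ∀ n k → suc k * (suc n C suc k) ≡ suc n * (n C k)
  [1+k]*[1+n]C[1+k]≡[1+n]*nCk n       zero    = ≡.trans (ℕ.*-identityˡ _) (≡.trans (nC1≡n (suc n)) (≡.sym (ℕ.*-identityʳ _)))
  [1+k]*[1+n]C[1+k]≡[1+n]*nCk zero    (suc k) = ≡.trans (cong (suc (suc k) *_) (k>n⇒nCk≡0 {1} {suc (suc k)} (s≤s (s≤s z≤n)))) (ℕ.*-zeroʳ (suc (suc k)))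
  [1+k]*[1+n]C[1+k]≡[1+n]*nCk (suc n) (suc k) = begin
    suc (suc k) * (suc (suc n) C suc (suc k))               ≡⟨ cong (suc (suc k) *_) (nCk+nC[k+1]≡[n+1]C[k+1] (suc n) (suc k)) ⟨
    suc (suc k) * (suc n C suc k + suc n C suc (suc k))     ≡⟨ split (suc k) (suc n C suc k) _ ⟩
    suc k * (suc n C suc k) + suc n C suc k + suc (suc k) * (suc n C suc (suc k))
      ≡⟨ cong₂ (λ x y → x + suc n C suc k + y) ([1+k]*[1+n]C[1+k]≡[1+n]*nCk n k) ([1+k]*[1+n]C[1+k]≡[1+n]*nCk n (suc k)) ⟩
    suc n * (n C k) + suc n C suc k + suc n * (n C suc k)   ≡⟨ merge (suc n) (n C k) (n C suc k) (suc n C suc k) ⟩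
    suc n * (n C k + n C suc k) + suc n C suc k             ≡⟨ cong (λ x → suc n * x + suc n C suc k) (nCk+nC[k+1]≡[n+1]C[k+1] n k) ⟩
    suc n * (suc n C suc k) + suc n C suc k                 ≡⟨ ℕ.+-comm (suc n * (suc n C suc k)) (suc n C suc k) ⟩
    suc (suc n) * (suc n C suc k)                           ∎
    where
    open ≡.≡-Reasoning
    split : ∀ k x y → suc k * (x + y) ≡ k * x + x + suc k * y
    split = solve-∀
    merge : ∀ n x y z → n * x + z + n * y ≡ n * (x + y) + z
    merge = solve-∀

  -- The coefficient of t^p in (t/(1-t))^j: (p-1) C (j-1), read with C(-1,-1) = 1 and C(p-1,-1) = 0 for p ≥ 1.
  predC : ℕ → ℕ → ℕ
  predC zero    zero    = 1
  predC zero    (suc j) = 0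
  predC (suc p) zero    = 0
  predC (suc p) (suc j) = p C j

  predC-pascal : ∀ p j → predC p (suc j) + predC p j ≡ predC (suc p) (suc j)
  predC-pascal zero    zero    = ≡.refl
  predC-pascal zero    (suc j) = ≡.refl
  predC-pascal (suc p) zero    = ℕ.+-identityʳ (p C 0)
  predC-pascal (suc p) (suc j) = ≡.trans (ℕ.+-comm (p C suc j) (p C j)) (nCk+nC[k+1]≡[n+1]C[k+1] p j)

  predC-vanish : ∀ {p j} → p ≤ j → predC p (suc j) ≡ 0
  predC-vanish {zero}          _         = ≡.refl
  predC-vanish {suc p} {suc j} (s≤s p≤j) = k>n⇒nCk≡0 (s≤s p≤j)

open Binomial

-- The ring solver needs coefficients with decidable equality; ℤ maps into every commutative ring.
module IntegerCoefficients {c ℓ : Level} (R : CommutativeRing c ℓ) where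
  open CommutativeRing R
  open import Algebra.Properties.Semiring.Mult.TCOptimised semiring using (_×_; ×-homo-+; ×1-homo-*)
  open import Algebra.Properties.Ring ring using (-‿involutive; -0#≈0#; -‿+-comm; -1*x≈-x)
  open import Algebra.Properties.CommutativeSemigroup *-commutativeSemigroup using (interchange)
  open import Relation.Binary.Reasoning.Setoid setoid

  ⟦_⟧ℤ : ℤ → Carrier
  ⟦ + n ⟧ℤ      = n × 1#
  ⟦ -[1+ n ] ⟧ℤ = - (suc n × 1#)

  private
    suc×1 : ∀ n → suc n × 1# ≈ 1# + n × 1#
    suc×1 = ×-homo-+ 1# 1

    ⟦⊖⟧+ : ∀ m n → ⟦ m ⊖ n ⟧ℤ + n × 1# ≈ m × 1#
    ⟦⊖⟧+ m zero = trans (+-congʳ (reflexive (≡.cong ⟦_⟧ℤ (ℤ.⊖-≥ {m} ℕ.z≤n)))) (+-identityʳ _)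
    ⟦⊖⟧+ zero (suc n) = trans (+-congʳ (reflexive (≡.cong ⟦_⟧ℤ (ℤ.⊖-≤ {0} {suc n} ℕ.z≤n)))) (-‿inverseˡ _)
    ⟦⊖⟧+ (suc m) (suc n) = begin
      ⟦ suc m ⊖ suc n ⟧ℤ + suc n × 1#  ≈⟨ +-cong (reflexive (≡.cong ⟦_⟧ℤ (ℤ.[1+m]⊖[1+n]≡m⊖n m n))) (suc×1 n) ⟩
      ⟦ m ⊖ n ⟧ℤ + (1# + n × 1#)       ≈⟨ x∙yz≈y∙xz _ _ _ ⟩
      1# + (⟦ m ⊖ n ⟧ℤ + n × 1#)       ≈⟨ +-congˡ (⟦⊖⟧+ m n) ⟩
      1# + m × 1#                      ≈⟨ suc×1 m ⟨
      suc m × 1#                       ∎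
      where open import Algebra.Properties.CommutativeSemigroup +-commutativeSemigroup using (x∙yz≈y∙xz)

    ⟦⊖⟧ : ∀ m n → ⟦ m ⊖ n ⟧ℤ ≈ m × 1# - n × 1#
    ⟦⊖⟧ m n = begin
      ⟦ m ⊖ n ⟧ℤ                      ≈⟨ +-identityʳ _ ⟨
      ⟦ m ⊖ n ⟧ℤ + 0#                 ≈⟨ +-congˡ (-‿inverseʳ (n × 1#)) ⟨
      ⟦ m ⊖ n ⟧ℤ + (n × 1# - n × 1#)  ≈⟨ +-assoc _ _ _ ⟨
      ⟦ m ⊖ n ⟧ℤ + n × 1# - n × 1#    ≈⟨ +-congʳ (⟦⊖⟧+ m n) ⟩
      m × 1# - n × 1#                 ∎

    ⟦sign⟧ : Sign → Carrier
    ⟦sign⟧ Sign.+ = 1#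
    ⟦sign⟧ Sign.- = - 1#

    ⟦sign⟧-homo-* : ∀ s t → ⟦sign⟧ (s Sign.* t) ≈ ⟦sign⟧ s * ⟦sign⟧ t
    ⟦sign⟧-homo-* Sign.+ t      = sym (*-identityˡ _)
    ⟦sign⟧-homo-* Sign.- Sign.+ = sym (*-identityʳ _)
    ⟦sign⟧-homo-* Sign.- Sign.- = trans (sym (-‿involutive 1#)) (sym (-1*x≈-x (- 1#)))

    ⟦◃⟧ : ∀ s k → ⟦ s ◃ k ⟧ℤ ≈ ⟦sign⟧ s * k × 1#
    ⟦◃⟧ s      zero    = sym (zeroʳ _)
    ⟦◃⟧ Sign.+ (suc k) = sym (*-identityˡ _)
    ⟦◃⟧ Sign.- (suc k) = sym (-1*x≈-x _)

    ⟦sign◃abs⟧ : ∀ i → ⟦ i ⟧ℤ ≈ ⟦sign⟧ (ℤ.sign i) * ℤ.∣ i ∣ × 1#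
    ⟦sign◃abs⟧ i = trans (reflexive (≡.cong ⟦_⟧ℤ (≡.sym (ℤ.◃-inverse i)))) (⟦◃⟧ (ℤ.sign i) ℤ.∣ i ∣)

  ⟦⟧ℤ-homo-+ : ∀ i j → ⟦ i ℤ.+ j ⟧ℤ ≈ ⟦ i ⟧ℤ + ⟦ j ⟧ℤ
  ⟦⟧ℤ-homo-+ (+ m)    (+ n)    = ×-homo-+ 1# m n
  ⟦⟧ℤ-homo-+ (+ m)    -[1+ n ] = ⟦⊖⟧ m (suc n)
  ⟦⟧ℤ-homo-+ -[1+ m ] (+ n)    = trans (⟦⊖⟧ n (suc m)) (+-comm _ _)
  ⟦⟧ℤ-homo-+ -[1+ m ] -[1+ n ] = begin
    - (suc (suc (m ℕ.+ n)) × 1#)       ≡⟨ ≡.cong (λ k → - (k × 1#)) (ℕ.+-suc (suc m) n) ⟨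
    - ((suc m ℕ.+ suc n) × 1#)         ≈⟨ -‿cong (×-homo-+ 1# (suc m) (suc n)) ⟩
    - (suc m × 1# + suc n × 1#)        ≈⟨ -‿+-comm _ _ ⟨
    - (suc m × 1#) + - (suc n × 1#)    ∎

  ⟦⟧ℤ-homo-* : ∀ i j → ⟦ i ℤ.* j ⟧ℤ ≈ ⟦ i ⟧ℤ * ⟦ j ⟧ℤ
  ⟦⟧ℤ-homo-* i j = begin
    ⟦ i ℤ.* j ⟧ℤ                                   ≈⟨ ⟦◃⟧ (ℤ.sign i Sign.* ℤ.sign j) (ℤ.∣ i ∣ ℕ.* ℤ.∣ j ∣) ⟩
    ⟦sign⟧ (ℤ.sign i Sign.* ℤ.sign j) * (ℤ.∣ i ∣ ℕ.* ℤ.∣ j ∣) × 1#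
      ≈⟨ *-cong (⟦sign⟧-homo-* (ℤ.sign i) (ℤ.sign j)) (×1-homo-* ℤ.∣ i ∣ ℤ.∣ j ∣) ⟩
    (⟦sign⟧ (ℤ.sign i) * ⟦sign⟧ (ℤ.sign j)) * (ℤ.∣ i ∣ × 1# * ℤ.∣ j ∣ × 1#)
      ≈⟨ interchange _ _ _ _ ⟩
    (⟦sign⟧ (ℤ.sign i) * ℤ.∣ i ∣ × 1#) * (⟦sign⟧ (ℤ.sign j) * ℤ.∣ j ∣ × 1#)
      ≈⟨ *-cong (⟦sign◃abs⟧ i) (⟦sign◃abs⟧ j) ⟨
    ⟦ i ⟧ℤ * ⟦ j ⟧ℤ                                ∎

  ⟦⟧ℤ-homo-‿ : ∀ i → ⟦ ℤ.- i ⟧ℤ ≈ - ⟦ i ⟧ℤ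
  ⟦⟧ℤ-homo-‿ (+ zero)  = sym -0#≈0#
  ⟦⟧ℤ-homo-‿ (+ suc n) = refl
  ⟦⟧ℤ-homo-‿ -[1+ n ]  = sym (-‿involutive _)

  ℤ⟶R : ℤ.+-*-rawRing -Raw-AlmostCommutative⟶ fromCommutativeRing R
  ℤ⟶R = record
    { ⟦_⟧ = ⟦_⟧ℤ ; +-homo = ⟦⟧ℤ-homo-+ ; *-homo = ⟦⟧ℤ-homo-* ; -‿homo = ⟦⟧ℤ-homo-‿
    ; 0-homo = refl ; 1-homo = refl }

  _≟ℤ_ : ∀ i j → Maybe (⟦ i ⟧ℤ ≈ ⟦ j ⟧ℤ)
  i ≟ℤ j with i ℤ.≟ j
  ... | yes ≡.refl = just refl
  ... | no _       = nothing

  open import Algebra.Solver.Ring ℤ.+-*-rawRing (fromCommutativeRing R) ℤ⟶R _≟ℤ_ public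

module FiniteSums {c ℓ : Level} (R : CommutativeRing c ℓ) where
  open CommutativeRing R
  open import Algebra.Properties.Ring ring using (-0#≈0#; -‿+-comm)
  open import Algebra.Properties.CommutativeSemigroup +-commutativeSemigroup using (interchange)
  open import Relation.Binary.Reasoning.Setoid setoid

  ∑< : ℕ → (ℕ → Carrier) → Carrier
  ∑< zero    f = 0#
  ∑< (suc n) f = ∑< n f + f n

  infix 6.5 ∑<
  syntax ∑< n (λ i → x) = ∑[ i < n ] x

  ∑-cong : ∀ n {f g : ℕ → Carrier} → (∀ i → i < n → f i ≈ g i) → ∑< n f ≈ ∑< n g
  ∑-cong zero    f≈g = refl
  ∑-cong (suc n) f≈g = +-cong (∑-cong n (λ i i<n → f≈g i (ℕ.m<n⇒m<1+n i<n))) (f≈g n ℕ.≤-refl)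

  ∑-zero : ∀ n (f : ℕ → Carrier) → (∀ i → i < n → f i ≈ 0#) → ∑< n f ≈ 0#
  ∑-zero n f f≈0 = trans (∑-cong n f≈0) (go n)
    where
    go : ∀ n → ∑[ i < n ] 0# ≈ 0#
    go zero    = refl
    go (suc n) = trans (+-identityʳ _) (go n)

  ∑-distrib-+ : ∀ n (f g : ℕ → Carrier) → ∑[ i < n ] (f i + g i) ≈ ∑< n f + ∑< n g
  ∑-distrib-+ zero    f g = sym (+-identityʳ 0#)
  ∑-distrib-+ (suc n) f g = trans (+-congʳ (∑-distrib-+ n f g)) (interchange _ _ _ _)

  *-distribˡ-∑ : ∀ n x (f : ℕ → Carrier) → x * ∑< n f ≈ ∑[ i < n ] (x * f i)
  *-distribˡ-∑ zero    x f = zeroʳ x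
  *-distribˡ-∑ (suc n) x f = trans (distribˡ x _ _) (+-congʳ (*-distribˡ-∑ n x f))

  *-distribʳ-∑ : ∀ n x (f : ℕ → Carrier) → ∑< n f * x ≈ ∑[ i < n ] (f i * x)
  *-distribʳ-∑ n x f = trans (*-comm _ x) (trans (*-distribˡ-∑ n x f) (∑-cong n (λ i _ → *-comm x (f i))))

  -‿∑ : ∀ n (f : ℕ → Carrier) → - ∑< n f ≈ ∑[ i < n ] - f i
  -‿∑ zero    f = -0#≈0#
  -‿∑ (suc n) f = trans (sym (-‿+-comm _ _)) (+-congʳ (-‿∑ n f))

  ∑-head : ∀ n (f : ℕ → Carrier) → ∑< (suc n) f ≈ f 0 + ∑[ i < n ] f (suc i)
  ∑-head zero    f = trans (+-identityˡ _) (sym (+-identityʳ _))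
  ∑-head (suc n) f = trans (+-congʳ (∑-head n f)) (+-assoc _ _ _)

  ∑-reverse : ∀ n (f : ℕ → Carrier) → ∑[ i < n ] f (n ∸ suc i) ≈ ∑< n f
  ∑-reverse zero    f = refl
  ∑-reverse (suc n) f = begin
    ∑[ i < suc n ] f (n ∸ i)           ≈⟨ ∑-head n (λ i → f (n ∸ i)) ⟩
    f n + ∑[ i < n ] f (n ∸ suc i)      ≈⟨ +-congˡ (∑-reverse n f) ⟩
    f n + ∑< n f                        ≈⟨ +-comm _ _ ⟩
    ∑< (suc n) f                        ∎

  ∑-comm : ∀ m n (f : ℕ → ℕ → Carrier) → ∑[ i < m ] ∑[ j < n ] f i j ≈ ∑[ j < n ] ∑[ i < m ] f i j
  ∑-comm zero    n f = sym (∑-zero n _ (λ _ _ → refl))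
  ∑-comm (suc m) n f = trans (+-congʳ (∑-comm m n f)) (sym (∑-distrib-+ n _ _))

  ∑-truncate : ∀ {m n} (f : ℕ → Carrier) → m ≤ n → (∀ i → m ≤ i → i < n → f i ≈ 0#) → ∑< n f ≈ ∑< m f
  ∑-truncate {m} f m≤n = go (ℕ.≤⇒≤′ m≤n)
    where
    go : ∀ {n} → m ≤′ n → (∀ i → m ≤ i → i < n → f i ≈ 0#) → ∑< n f ≈ ∑< m f
    go ≤′-refl        _   = refl
    go (≤′-step m≤′n) f≈0 = trans (+-cong (go m≤′n (λ i m≤i i<n → f≈0 i m≤i (ℕ.m<n⇒m<1+n i<n)))
                                          (f≈0 _ (ℕ.≤′⇒≤ m≤′n) ℕ.≤-refl))
                                  (+-identityʳ _)

  when : Bool → Carrier → Carrier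
  when true  x = x
  when false x = 0#

  when-cong : ∀ b {x y} → x ≈ y → when b x ≈ when b y
  when-cong true  x≈y = x≈y
  when-cong false x≈y = refl

  when-∧ : ∀ a b x → when (a ∧ b) x ≡ when a (when b x)
  when-∧ true  b x = ≡.refl
  when-∧ false b x = ≡.refl

  *-when : ∀ b x y → x * when b y ≈ when b (x * y)
  *-when true  x y = refl
  *-when false x y = zeroʳ x

  ∑-when-< : ∀ {m n} (f : ℕ → Carrier) → m ≤ n → ∑[ i < n ] when (suc i ≤ᵇ m) (f i) ≈ ∑< m f
  ∑-when-< {m} f m≤n = trans (∑-truncate _ m≤n (λ i m≤i _ → dropped i m≤i)) (∑-cong m (λ i i<m → kept i i<m))
    where
    dropped : ∀ i → m ≤ i → when (suc i ≤ᵇ m) (f i) ≈ 0#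
    dropped i m≤i with suc i ≤ᵇ m in eq
    ... | false = refl
    ... | true  = ⊥-elim (ℕ.<⇒≱ (ℕ.≤ᵇ⇒≤ (suc i) m (≡.subst T (≡.sym eq) _)) m≤i)
    kept : ∀ i → i < m → when (suc i ≤ᵇ m) (f i) ≈ f i
    kept i i<m with suc i ≤ᵇ m in eq
    ... | true  = refl
    ... | false = ⊥-elim (≡.subst T eq (ℕ.≤⇒≤ᵇ i<m))

private
  variable
    ℓa ℓb : Level
    A : Set ℓa
    B : Set ℓb

module Polylogarithm {c ℓ₁ ℓ₂ : Level} (F : HeytingField c ℓ₁ ℓ₂) where
  open HeytingField F using (Carrier; _≈_; _+_; _*_; -_; _-_; 0#; 1#; #⇒invertible; heytingCommutativeRing)
  open WithField F

  R : CommutativeRing c ℓ₁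
  R = HeytingCommutativeRing.commutativeRing heytingCommutativeRing

  open CommutativeRing R using (setoid; refl; sym; trans; reflexive; +-cong; +-congˡ; +-congʳ; *-cong; *-congˡ; *-congʳ; -‿cong;
    +-identityˡ; +-identityʳ; +-assoc; +-comm; *-identityˡ; *-identityʳ; *-assoc; zeroˡ; zeroʳ; distribˡ; distribʳ)
  open IntegerCoefficients R using (Polynomial; solve; _:=_; _:+_; _:*_; _:-_; :-_; con)
  open FiniteSums R
  open import Relation.Binary.Reasoning.Setoid setoid
  open import Algebra.Properties.Ring (CommutativeRing.ring R) using (-0#≈0#; -‿involutive)
  open import Algebra.Properties.CommutativeSemigroup (CommutativeRing.+-commutativeSemigroup R) using (x∙yz≈y∙xz)
  open import Algebra.Properties.CommutativeSemigroup (CommutativeRing.*-commutativeSemigroup R) using () renaming (x∙yz≈y∙xz to x*yz≈y*xz)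

  private
    one : ∀ {k} → Polynomial k
    one = con (+ 1)

  ι-homo-+ : ∀ m n → ι (m ℕ.+ n) ≈ ι m + ι n
  ι-homo-+ zero    n = sym (+-identityˡ (ι n))
  ι-homo-+ (suc m) n = trans (+-congˡ (ι-homo-+ m n)) (sym (+-assoc 1# (ι m) (ι n)))

  ι-homo-* : ∀ m n → ι (m ℕ.* n) ≈ ι m * ι n
  ι-homo-* zero    n = sym (zeroˡ (ι n))
  ι-homo-* (suc m) n = begin
    ι (n ℕ.+ m ℕ.* n)        ≈⟨ ι-homo-+ n (m ℕ.* n) ⟩
    ι n + ι (m ℕ.* n)        ≈⟨ +-cong (sym (*-identityˡ (ι n))) (ι-homo-* m n) ⟩
    1# * ι n + ι m * ι n     ≈⟨ distribʳ (ι n) 1# (ι m) ⟨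
    (1# + ι m) * ι n         ∎

  sumTo≈∑ : ∀ n (f : ℕ → Carrier) → sumTo n f ≈ ∑< (suc n) f
  sumTo≈∑ zero    f = sym (+-identityˡ _)
  sumTo≈∑ (suc n) f = +-congʳ (sumTo≈∑ n f)

  hockey-stick : ∀ t j → ∑[ k < t ] ι (k C j) ≈ ι (t C suc j)
  hockey-stick zero    j = refl
  hockey-stick (suc t) j = begin
    ∑[ k < t ] ι (k C j) + ι (t C j)  ≈⟨ +-congʳ (hockey-stick t j) ⟩
    ι (t C suc j) + ι (t C j)         ≈⟨ +-comm _ _ ⟩
    ι (t C j) + ι (t C suc j)         ≈⟨ ι-homo-+ (t C j) (t C suc j) ⟨
    ι (t C j ℕ.+ t C suc j)           ≡⟨ ≡.cong ι (nCk+nC[k+1]≡[n+1]C[k+1] t j) ⟩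
    ι (suc t C suc j)                 ∎

  predC-hockey-stick : ∀ p j → ∑[ i < p ] ι (predC i j) ≈ ι (predC p (suc j))
  predC-hockey-stick zero    j = refl
  predC-hockey-stick (suc p) j = begin
    ∑[ i < p ] ι (predC i j) + ι (predC p j)  ≈⟨ +-congʳ (predC-hockey-stick p j) ⟩
    ι (predC p (suc j)) + ι (predC p j)       ≈⟨ ι-homo-+ (predC p (suc j)) (predC p j) ⟨
    ι (predC p (suc j) ℕ.+ predC p j)         ≡⟨ ≡.cong ι (predC-pascal p j) ⟩
    ι (predC (suc p) (suc j))                 ∎

  falling-cong : ∀ k {x y} → x ≈ y → falling x k ≈ falling y k
  falling-cong zero    x≈y = refl
  falling-cong (suc k) x≈y = *-cong (falling-cong k x≈y) (+-congʳ x≈y)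

  falling-suc : ∀ r y → falling (y + 1#) (suc r) ≈ (y + 1#) * falling y r
  falling-suc zero    y = solve 1 (λ y → one :* ((y :+ one) :- con (+ 0)) := (y :+ one) :* one) refl y
  falling-suc (suc r) y = begin
    falling (y + 1#) (suc r) * ((y + 1#) - ι (suc r))         ≈⟨ *-congʳ (falling-suc r y) ⟩
    ((y + 1#) * falling y r) * ((y + 1#) - (1# + ι r))        ≈⟨ solve 3 (λ y G t → ((y :+ one) :* G) :* ((y :+ one) :- (one :+ t)) := (y :+ one) :* (G :* (y :- t))) refl y (falling y r) (ι r) ⟩
    (y + 1#) * (falling y r * (y - ι r))                      ∎

  falling-reflect : ∀ s z → falling (z + ι s) s ≈ sign s * falling (- z - 1#) s
  falling-reflect zero    z = sym (*-identityˡ 1#)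
  falling-reflect (suc s) z = begin
    falling (z + ι (suc s)) (suc s)                 ≈⟨ falling-cong (suc s) (solve 2 (λ z t → z :+ (one :+ t) := (z :+ t) :+ one) refl z (ι s)) ⟩
    falling ((z + ι s) + 1#) (suc s)                ≈⟨ falling-suc s (z + ι s) ⟩
    ((z + ι s) + 1#) * falling (z + ι s) s          ≈⟨ *-congˡ (falling-reflect s z) ⟩
    ((z + ι s) + 1#) * (sign s * G)                 ≈⟨ solve 4 (λ z t S G → ((z :+ t) :+ one) :* (S :* G) := (:- one :* S) :* (G :* ((:- z :- one) :- t))) refl z (ι s) (sign s) G ⟩
    (- 1# * sign s) * (G * ((- z - 1#) - ι s))      ∎
    where G = falling (- z - 1#) s

  sign*sign≈1# : ∀ j → sign j * sign j ≈ 1#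
  sign*sign≈1# zero    = *-identityˡ 1#
  sign*sign≈1# (suc j) = trans (solve 1 (λ S → (:- one :* S) :* (:- one :* S) := S :* S) refl (sign j)) (sign*sign≈1# j)


  Σ-map-cong : ∀ {f g : A → Carrier} xs → (∀ x → f x ≈ g x) → Σ[ map f xs ] ≈ Σ[ map g xs ]
  Σ-map-cong []       f≈g = refl
  Σ-map-cong (x ∷ xs) f≈g = +-cong (f≈g x) (Σ-map-cong xs f≈g)

  Σ-map-++ : ∀ (f : A → Carrier) xs ys → Σ[ map f (xs ++ ys) ] ≈ Σ[ map f xs ] + Σ[ map f ys ]
  Σ-map-++ f []       ys = sym (+-identityˡ _)
  Σ-map-++ f (x ∷ xs) ys = trans (+-congˡ (Σ-map-++ f xs ys)) (sym (+-assoc _ _ _))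

  *-distribˡ-Σ : ∀ y (f : A → Carrier) xs → y * Σ[ map f xs ] ≈ Σ[ map (λ x → y * f x) xs ]
  *-distribˡ-Σ y f []       = zeroʳ y
  *-distribˡ-Σ y f (x ∷ xs) = trans (distribˡ y _ _) (+-congˡ (*-distribˡ-Σ y f xs))

  Σ-map-when : ∀ b (f : A → Carrier) xs → Σ[ map (λ x → when b (f x)) xs ] ≈ when b Σ[ map f xs ]
  Σ-map-when true  f xs       = refl
  Σ-map-when false f []       = refl
  Σ-map-when false f (x ∷ xs) = trans (+-identityˡ _) (Σ-map-when false f xs)

  Σ-map-when-* : ∀ (p : A → Bool) y (f : A → Carrier) xs →
                 Σ[ map (λ x → when (p x) (y * f x)) xs ] ≈ y * Σ[ map (λ x → when (p x) (f x)) xs ]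
  Σ-map-when-* p y f xs = trans (Σ-map-cong xs (λ x → sym (*-when (p x) y (f x)))) (sym (*-distribˡ-Σ y _ xs))

  Σ-filterᵇ : ∀ (f : A → Carrier) (p : A → Bool) xs → Σ[ map f (filterᵇ p xs) ] ≈ Σ[ map (λ x → when (p x) (f x)) xs ]
  Σ-filterᵇ f p []       = refl
  Σ-filterᵇ f p (x ∷ xs) with p x
  ... | true  = +-congˡ (Σ-filterᵇ f p xs)
  ... | false = trans (Σ-filterᵇ f p xs) (sym (+-identityˡ _))

  Σ-map-applyUpTo : ∀ (f : A → Carrier) (g : ℕ → A) n → Σ[ map f (applyUpTo g n) ] ≈ ∑[ i < n ] f (g i)
  Σ-map-applyUpTo f g zero    = refl
  Σ-map-applyUpTo f g (suc n) = trans (+-congˡ (Σ-map-applyUpTo f (λ i → g (suc i)) n)) (sym (∑-head n (λ i → f (g i))))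

  Σ-map-concatMap : ∀ (f : B → Carrier) (h : A → List B) xs → Σ[ map f (concatMap h xs) ] ≈ Σ[ map (λ x → Σ[ map f (h x) ]) xs ]
  Σ-map-concatMap f h []       = refl
  Σ-map-concatMap f h (x ∷ xs) = trans (Σ-map-++ f (h x) (concatMap h xs)) (+-congˡ (Σ-map-concatMap f h xs))

  Σ-map-map : ∀ (f : B → Carrier) (g : A → B) xs → Σ[ map f (map g xs) ] ≡ Σ[ map (λ x → f (g x)) xs ]
  Σ-map-map f g xs = ≡.cong Σ[_] (≡.sym (List.map-∘ xs))

  module WithChar0 (char0 : CharZero) where
    open WithCharZero char0

    ι[1+j]*invSuc[j]≈1# : ∀ j → ι (suc j) * invSuc j ≈ 1#
    ι[1+j]*invSuc[j]≈1# j = trans (*-congʳ (sym (trans (+-congˡ -0#≈0#) (+-identityʳ _)))) (proj₂ (proj₂ (#⇒invertible (char0 j))))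

    binom-cong : ∀ k {x y} → x ≈ y → binom x k ≈ binom y k
    binom-cong k x≈y = *-congʳ (falling-cong k x≈y)

    binom-pascal : ∀ r y → binom (y + 1#) (suc r) ≈ binom y r + binom y (suc r)
    binom-pascal r y = begin
      falling (y + 1#) (suc r) * (invFact r * invSuc r)       ≈⟨ *-congʳ (falling-suc r y) ⟩
      ((y + 1#) * Fr) * (I * v)                               ≈⟨ solve 5 (λ y Fr I v t → ((y :+ one) :* Fr) :* (I :* v) := (Fr :* I) :* ((one :+ t) :* v) :+ (Fr :* (y :- t)) :* (I :* v)) refl y Fr I v (ι r) ⟩
      (Fr * I) * (ι (suc r) * v) + (Fr * (y - ι r)) * (I * v)  ≈⟨ +-congʳ (trans (*-congˡ (ι[1+j]*invSuc[j]≈1# r)) (*-identityʳ _)) ⟩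
      Fr * I + (Fr * (y - ι r)) * (I * v)                     ∎
      where Fr = falling y r; I = invFact r; v = invSuc r

    vandermonde : ∀ k r x → ∑[ i < suc r ] ι (k C i) * binom x (r ∸ i) ≈ binom (x + ι k) r
    vandermonde zero r x = begin
      ∑[ i < suc r ] ι (0 C i) * binom x (r ∸ i)                     ≈⟨ ∑-head r _ ⟩
      (1# + 0#) * binom x r + ∑[ i < r ] 0# * binom x (r ∸ suc i)    ≈⟨ +-cong (trans (*-congʳ (+-identityʳ 1#)) (*-identityˡ _)) (∑-zero r _ (λ i _ → zeroˡ _)) ⟩
      binom x r + 0#                                                 ≈⟨ +-identityʳ _ ⟩
      binom x r                                                      ≈⟨ binom-cong r (+-identityʳ x) ⟨
      binom (x + 0#) r                                               ∎
    vandermonde (suc k) zero    x = solve 0 (con (+ 0) :+ (one :+ con (+ 0)) :* (one :* one) := one :* one) refl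
    vandermonde (suc k) (suc r) x = begin
      ∑[ i < suc (suc r) ] ι (suc k C i) * binom x (suc r ∸ i)                      ≈⟨ ∑-head (suc r) _ ⟩
      (1# + 0#) * binom x (suc r) + ∑[ i < suc r ] ι (suc k C suc i) * binom x (r ∸ i)
        ≈⟨ +-cong (trans (*-congʳ (+-identityʳ 1#)) (*-identityˡ _)) (∑-cong (suc r) (λ i _ → *-congʳ (ι-pascal i))) ⟩
      binom x (suc r) + ∑[ i < suc r ] (ι (k C i) + ι (k C suc i)) * binom x (r ∸ i)
        ≈⟨ +-congˡ (trans (∑-cong (suc r) (λ i _ → distribʳ _ _ _)) (∑-distrib-+ (suc r) _ _)) ⟩
      binom x (suc r) + (∑[ i < suc r ] ι (k C i) * binom x (r ∸ i) + S)           ≈⟨ +-congˡ (+-congʳ (vandermonde k r x)) ⟩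
      binom x (suc r) + (binom (x + ι k) r + S)                                     ≈⟨ x∙yz≈y∙xz _ _ _ ⟩
      binom (x + ι k) r + (binom x (suc r) + S)                                     ≈⟨ +-congˡ next ⟩
      binom (x + ι k) r + binom (x + ι k) (suc r)                                   ≈⟨ binom-pascal r (x + ι k) ⟨
      binom ((x + ι k) + 1#) (suc r)                                                ≈⟨ binom-cong (suc r) (solve 2 (λ x t → (x :+ t) :+ one := x :+ (one :+ t)) refl x (ι k)) ⟩
      binom (x + ι (suc k)) (suc r)                                                 ∎
      where
      S = ∑[ i < suc r ] ι (k C suc i) * binom x (suc r ∸ suc i)
      ι-pascal : ∀ i → ι (suc k C suc i) ≈ ι (k C i) + ι (k C suc i)
      ι-pascal i = trans (reflexive (≡.cong ι (≡.sym (nCk+nC[k+1]≡[n+1]C[k+1] k i)))) (ι-homo-+ (k C i) (k C suc i))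
      next : binom x (suc r) + S ≈ binom (x + ι k) (suc r)
      next = trans (+-congʳ (trans (sym (*-identityˡ _)) (*-congʳ (sym (+-identityʳ 1#)))))
                   (trans (sym (∑-head (suc r) (λ i → ι (k C i) * binom x (suc r ∸ i)))) (vandermonde k (suc r) x))

    β : Carrier → ℕ → Carrier
    β lam j = binom (- lam - 1#) j

    signed-binom-expansion : ∀ lam {s n} → s < n → sign s * binom (lam - 1#) s ≈ ∑[ j < n ] ι (suc s C suc j) * β lam j
    signed-binom-expansion lam {s} {n} s<n = sym (begin
      ∑[ j < n ] ι (suc s C suc j) * β lam j                  ≈⟨ ∑-truncate _ s<n (λ j s<j _ → vanish j s<j) ⟩
      ∑[ j < suc s ] ι (suc s C suc j) * binom x j             ≈⟨ ∑-reverse (suc s) _ ⟨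
      ∑[ i < suc s ] ι (suc s C suc (s ∸ i)) * binom x (s ∸ i) ≈⟨ ∑-cong (suc s) (λ i i≤s → *-congʳ (reflexive (≡.cong ι (symmetry i (ℕ.≤-pred i≤s))))) ⟩
      ∑[ i < suc s ] ι (suc s C i) * binom x (s ∸ i)           ≈⟨ vandermonde (suc s) s x ⟩
      falling (x + ι (suc s)) s * invFact s                    ≈⟨ *-congʳ (falling-cong s (solve 2 (λ l t → ((:- l) :- one) :+ (one :+ t) := (:- l) :+ t) refl lam (ι s))) ⟩
      falling (- lam + ι s) s * invFact s                      ≈⟨ *-congʳ (falling-reflect s (- lam)) ⟩
      (sign s * falling (- - lam - 1#) s) * invFact s          ≈⟨ *-congʳ (*-congˡ (falling-cong s (+-congʳ (-‿involutive lam)))) ⟩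
      (sign s * falling (lam - 1#) s) * invFact s              ≈⟨ *-assoc _ _ _ ⟩
      sign s * binom (lam - 1#) s                              ∎)
      where
      x = - lam - 1#
      vanish : ∀ j → s < j → ι (suc s C suc j) * β lam j ≈ 0#
      vanish j s<j = trans (*-congʳ (reflexive (≡.cong ι (k>n⇒nCk≡0 (ℕ.s≤s s<j))))) (zeroˡ _)
      symmetry : ∀ i → i ≤ s → suc s C suc (s ∸ i) ≡ suc s C i
      symmetry i i≤s = ≡.sym (≡.trans (nCk≡nC[n∸k] (ℕ.m≤n⇒m≤1+n i≤s)) (≡.cong (suc s C_) (ℕ.+-∸-assoc 1 i≤s)))

    Σ-tuples-suc : ∀ m n (f : Vec ℕ (suc m) → Carrier) → Σ[ map f (tuples (suc m) n) ] ≈ ∑[ i < n ] Σ[ map (λ w → f (suc i ∷ w)) (tuples m n) ]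
    Σ-tuples-suc m n f = begin
      Σ[ map f (concatMap (λ k → map (k ∷_) (tuples m n)) (map suc (upTo n))) ]  ≈⟨ Σ-map-concatMap f _ (map suc (upTo n)) ⟩
      Σ[ map (λ k → Σ[ map f (map (k ∷_) (tuples m n)) ]) (map suc (upTo n)) ]   ≡⟨ Σ-map-map _ suc (upTo n) ⟩
      Σ[ map (λ i → Σ[ map f (map (suc i ∷_) (tuples m n)) ]) (upTo n) ]         ≈⟨ Σ-map-applyUpTo _ (λ i → i) n ⟩
      ∑[ i < n ] Σ[ map f (map (suc i ∷_) (tuples m n)) ]                       ≈⟨ ∑-cong n (λ i _ → reflexive (Σ-map-map f (suc i ∷_) (tuples m n))) ⟩
      ∑[ i < n ] Σ[ map (λ w → f (suc i ∷ w)) (tuples m n) ]                    ∎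

    harmonicTail : ℕ → ℕ → ℕ → Carrier
    harmonicTail m n k = Σ[ map (λ w → when (nondecreasing (k ∷ w)) (invProd w)) (tuples m n) ]

    harmonicTail-zero : ∀ n k → harmonicTail 0 n k ≈ 1#
    harmonicTail-zero n k = +-identityʳ 1#

    harmonicTail-suc : ∀ m n k →
                       harmonicTail (suc m) n k ≈ ∑[ j < n ] when (k ℕ.≤ᵇ suc j) (invSuc j * harmonicTail m n (suc j))
    harmonicTail-suc m n k = trans (Σ-tuples-suc m n _) (∑-cong n (λ j _ → begin
      Σ[ map (λ w → when (nondecreasing (k ∷ suc j ∷ w)) (invSuc j * invProd w)) (tuples m n) ]
        ≡⟨ ≡.cong Σ[_] (List.map-cong (λ w → when-∧ (k ℕ.≤ᵇ suc j) (nondecreasing (suc j ∷ w)) _) (tuples m n)) ⟩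
      Σ[ map (λ w → when (k ℕ.≤ᵇ suc j) (when (nondecreasing (suc j ∷ w)) (invSuc j * invProd w))) (tuples m n) ]
        ≈⟨ Σ-map-when (k ℕ.≤ᵇ suc j) _ (tuples m n) ⟩
      when (k ℕ.≤ᵇ suc j) Σ[ map (λ w → when (nondecreasing (suc j ∷ w)) (invSuc j * invProd w)) (tuples m n) ]
        ≈⟨ when-cong (k ℕ.≤ᵇ suc j) (Σ-map-when-* (λ w → nondecreasing (suc j ∷ w)) (invSuc j) invProd (tuples m n)) ⟩
      when (k ℕ.≤ᵇ suc j) (invSuc j * harmonicTail m n (suc j))                                   ∎))

    RHS-suc : ∀ m lam n → RHS (suc m) lam n ≈ ∑[ i < n ] (sign i * binom (lam - 1#) i * invSuc i) * harmonicTail m n (suc i)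
    RHS-suc m lam n = begin
      RHS (suc m) lam n                                                                        ≈⟨ Σ-filterᵇ (summand lam) nondecreasing (tuples (suc m) n) ⟩
      Σ[ map (λ w → when (nondecreasing w) (summand lam w)) (tuples (suc m) n) ]              ≈⟨ Σ-tuples-suc m n _ ⟩
      ∑[ i < n ] Σ[ map (λ w → when (nondecreasing (suc i ∷ w)) (summand lam (suc i ∷ w))) (tuples m n) ]
        ≈⟨ ∑-cong n (λ i _ → trans (Σ-map-cong (tuples m n) (λ w → when-cong (nondecreasing (suc i ∷ w)) (regroup i w)))
                                   (Σ-map-when-* (λ w → nondecreasing (suc i ∷ w)) _ invProd (tuples m n))) ⟩
      ∑[ i < n ] (sign i * binom (lam - 1#) i * invSuc i) * harmonicTail m n (suc i)          ∎
      where
      regroup : ∀ i {m} (w : Vec ℕ m) → summand lam (suc i ∷ w) ≈ (sign i * binom (lam - 1#) i * invSuc i) * invProd w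
      regroup i w = solve 4 (λ S v p b → S :* (v :* p) :* b := (S :* b :* v) :* p) refl (sign i) (invSuc i) (invProd w) (binom (lam - 1#) i)

    ι-C-absorption : ∀ t j → ι (suc t C suc j) * invSuc t ≈ ι (t C j) * invSuc j
    ι-C-absorption t j = begin
      X * ib                        ≈⟨ trans (*-congˡ (ι[1+j]*invSuc[j]≈1# j)) (*-identityʳ _) ⟨
      (X * ib) * (u * ia)           ≈⟨ solve 4 (λ X ib u ia → (X :* ib) :* (u :* ia) := ((u :* X) :* ib) :* ia) refl X ib u ia ⟩
      ((u * X) * ib) * ia           ≈⟨ *-congʳ (*-congʳ absorb) ⟩
      ((v * Y) * ib) * ia           ≈⟨ solve 4 (λ Y ib v ia → ((v :* Y) :* ib) :* ia := (Y :* ia) :* (v :* ib)) refl Y ib v ia ⟩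
      (Y * ia) * (v * ib)           ≈⟨ trans (*-congˡ (ι[1+j]*invSuc[j]≈1# t)) (*-identityʳ _) ⟩
      Y * ia                        ∎
      where
      X = ι (suc t C suc j); Y = ι (t C j); u = ι (suc j); v = ι (suc t); ia = invSuc j; ib = invSuc t
      absorb : u * X ≈ v * Y
      absorb = trans (sym (ι-homo-* (suc j) (suc t C suc j)))
                     (trans (reflexive (≡.cong ι ([1+k]*[1+n]C[1+k]≡[1+n]*nCk t j))) (ι-homo-* (suc t) (t C j)))

    hockey-stick-absorbed : ∀ t j → ∑[ k < t ] ι (suc k C suc j) * invSuc k ≈ ι (t C suc j) * invSuc j
    hockey-stick-absorbed t j = begin
      ∑[ k < t ] ι (suc k C suc j) * invSuc k    ≈⟨ ∑-cong t (λ k _ → ι-C-absorption k j) ⟩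
      ∑[ k < t ] ι (k C j) * invSuc j            ≈⟨ *-distribʳ-∑ t (invSuc j) _ ⟨
      (∑[ k < t ] ι (k C j)) * invSuc j          ≈⟨ *-congʳ (hockey-stick t j) ⟩
      ι (t C suc j) * invSuc j                   ∎

    harmonic-identity : ∀ m n j →
      ∑[ k < n ] (ι (suc k C suc j) * invSuc k) * harmonicTail m n (suc k) ≈ ι (n C suc j) * invSuc j ^ suc m
    harmonic-identity zero n j = begin
      ∑[ k < n ] (ι (suc k C suc j) * invSuc k) * harmonicTail 0 n (suc k)  ≈⟨ ∑-cong n (λ k _ → trans (*-congˡ (harmonicTail-zero n (suc k))) (*-identityʳ _)) ⟩
      ∑[ k < n ] ι (suc k C suc j) * invSuc k                             ≈⟨ hockey-stick-absorbed n j ⟩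
      ι (n C suc j) * invSuc j                                            ≈⟨ *-congˡ (*-identityʳ _) ⟨
      ι (n C suc j) * invSuc j ^ 1                                        ∎
    harmonic-identity (suc m) n j = begin
      ∑[ k < n ] w k * harmonicTail (suc m) n (suc k)                      ≈⟨ ∑-cong n (λ k _ → *-congˡ (harmonicTail-suc m n (suc k))) ⟩
      ∑[ k < n ] w k * (∑[ l < n ] when (suc k ℕ.≤ᵇ suc l) (h l))            ≈⟨ ∑-cong n (λ k _ → trans (*-distribˡ-∑ n (w k) _) (∑-cong n (λ l _ → *-when (suc k ℕ.≤ᵇ suc l) (w k) (h l)))) ⟩
      ∑[ k < n ] ∑[ l < n ] when (suc k ℕ.≤ᵇ suc l) (w k * h l)              ≈⟨ ∑-comm n n _ ⟩
      ∑[ l < n ] ∑[ k < n ] when (suc k ℕ.≤ᵇ suc l) (w k * h l)              ≈⟨ ∑-cong n (λ l l<n → ∑-when-< (λ k → w k * h l) l<n) ⟩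
      ∑[ l < n ] ∑[ k < suc l ] w k * h l                                  ≈⟨ ∑-cong n (λ l _ → trans (sym (*-distribʳ-∑ (suc l) (h l) w)) (*-congʳ (hockey-stick-absorbed (suc l) j))) ⟩
      ∑[ l < n ] (ι (suc l C suc j) * invSuc j) * h l                       ≈⟨ ∑-cong n (λ l _ → solve 4 (λ A ij il H → (A :* ij) :* (il :* H) := ij :* ((A :* il) :* H)) refl (ι (suc l C suc j)) (invSuc j) (invSuc l) (harmonicTail m n (suc l))) ⟩
      ∑[ l < n ] invSuc j * (w l * harmonicTail m n (suc l))                ≈⟨ *-distribˡ-∑ n (invSuc j) _ ⟨
      invSuc j * (∑[ l < n ] w l * harmonicTail m n (suc l))                ≈⟨ *-congˡ (harmonic-identity m n j) ⟩
      invSuc j * (ι (n C suc j) * invSuc j ^ suc m)                        ≈⟨ x*yz≈y*xz (invSuc j) _ _ ⟩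
      ι (n C suc j) * invSuc j ^ suc (suc m)                               ∎
      where
      w : ℕ → Carrier
      w k = ι (suc k C suc j) * invSuc k
      h : ℕ → Carrier
      h l = invSuc l * harmonicTail m n (suc l)

    argS-zero : argS 0 ≈ 0#
    argS-zero = trans (-‿cong (zeroˡ 1#)) -0#≈0#

    argS-suc : ∀ i → argS (suc i) ≈ - 1#
    argS-suc i = -‿cong (geometric i)
      where
      geometric : ∀ i → (tS ⊛ geomS) (suc i) ≈ 1#
      geometric zero    = solve 0 (con (+ 0) :* one :+ one :* one := one) refl
      geometric (suc i) = trans (+-congʳ (geometric i)) (solve 0 (one :+ con (+ 0) :* one := one) refl)

    argS-pow : ∀ j p → (argS ⊛^ j) p ≈ sign j * ι (predC p j)
    argS-pow zero    zero    = sym (trans (*-identityˡ _) (+-identityʳ 1#))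
    argS-pow zero    (suc p) = sym (zeroʳ 1#)
    argS-pow (suc j) p = begin
      sumTo p (λ i → argS i * (argS ⊛^ j) (p ∸ i))                                  ≈⟨ trans (sumTo≈∑ p _) (∑-head p _) ⟩
      argS 0 * (argS ⊛^ j) p + ∑[ i < p ] argS (suc i) * (argS ⊛^ j) (p ∸ suc i)
        ≈⟨ +-cong (trans (*-congʳ argS-zero) (zeroˡ _)) (∑-cong p (λ i _ → *-cong (argS-suc i) (argS-pow j (p ∸ suc i)))) ⟩
      0# + ∑[ i < p ] - 1# * (sign j * ι (predC (p ∸ suc i) j))                    ≈⟨ trans (+-identityˡ _) (∑-cong p (λ i _ → sym (*-assoc _ _ _))) ⟩
      ∑[ i < p ] sign (suc j) * ι (predC (p ∸ suc i) j)                            ≈⟨ *-distribˡ-∑ p _ _ ⟨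
      sign (suc j) * (∑[ i < p ] ι (predC (p ∸ suc i) j))                            ≈⟨ *-congˡ (∑-reverse p (λ i → ι (predC i j))) ⟩
      sign (suc j) * (∑[ i < p ] ι (predC i j))                                      ≈⟨ *-congˡ (predC-hockey-stick p j) ⟩
      sign (suc j) * ι (predC p (suc j))                                           ∎

    Li∘argS : ∀ m lam p → (Li m (- lam) ∘S argS) p ≈ - (∑[ j < p ] (invSuc j ^ m * β lam j) * ι (predC p (suc j)))
    Li∘argS m lam p = begin
      sumTo p (λ j → Li m (- lam) j * (argS ⊛^ j) p)                               ≈⟨ trans (sumTo≈∑ p _) (∑-head p _) ⟩
      0# * (argS ⊛^ 0) p + ∑[ j < p ] Li m (- lam) (suc j) * (argS ⊛^ suc j) p     ≈⟨ trans (+-congʳ (zeroˡ _)) (+-identityˡ _) ⟩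
      ∑[ j < p ] Li m (- lam) (suc j) * (argS ⊛^ suc j) p                          ≈⟨ ∑-cong p (λ j _ → term j) ⟩
      ∑[ j < p ] - ((invSuc j ^ m * β lam j) * ι (predC p (suc j)))                 ≈⟨ -‿∑ p _ ⟨
      - (∑[ j < p ] (invSuc j ^ m * β lam j) * ι (predC p (suc j)))                   ∎
      where
      term : ∀ j → Li m (- lam) (suc j) * (argS ⊛^ suc j) p ≈ - ((invSuc j ^ m * β lam j) * ι (predC p (suc j)))
      term j = begin
        (sign j * invSuc j ^ m * β lam j) * (argS ⊛^ suc j) p                         ≈⟨ *-congˡ (argS-pow (suc j) p) ⟩
        (sign j * invSuc j ^ m * β lam j) * (sign (suc j) * ι (predC p (suc j)))
          ≈⟨ solve 4 (λ S u b x → (S :* u :* b) :* ((:- one :* S) :* x) := :- ((S :* S) :* ((u :* b) :* x))) refl (sign j) (invSuc j ^ m) (β lam j) (ι (predC p (suc j))) ⟩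
        - ((sign j * sign j) * ((invSuc j ^ m * β lam j) * ι (predC p (suc j))))     ≈⟨ -‿cong (trans (*-congʳ (sign*sign≈1# j)) (*-identityˡ _)) ⟩
        - ((invSuc j ^ m * β lam j) * ι (predC p (suc j)))                            ∎

    K-closed-form : ∀ m lam n → K m lam n ≈ ∑[ j < n ] (invSuc j ^ m * β lam j) * ι (n C suc j)
    K-closed-form m lam n = begin
      - sumTo n (λ i → 1# * L (n ∸ i))                  ≈⟨ -‿cong (trans (sumTo≈∑ n _) (∑-cong (suc n) (λ i _ → *-identityˡ _))) ⟩
      - (∑[ i < suc n ] L (n ∸ i))                     ≈⟨ -‿cong (∑-reverse (suc n) L) ⟩
      - (∑[ p < suc n ] L p)                              ≈⟨ -‿cong (∑-cong (suc n) (λ p p≤n → trans (Li∘argS m lam p) (-‿cong (sym (widen (ℕ.≤-pred p≤n)))))) ⟩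
      - (∑[ p < suc n ] - (∑[ j < n ] φ j p))             ≈⟨ -‿cong (-‿∑ (suc n) _) ⟨
      - - (∑[ p < suc n ] ∑[ j < n ] φ j p)                ≈⟨ -‿involutive _ ⟩
      ∑[ p < suc n ] ∑[ j < n ] φ j p                   ≈⟨ ∑-comm (suc n) n _ ⟩
      ∑[ j < n ] ∑[ p < suc n ] φ j p                   ≈⟨ ∑-cong n (λ j _ → trans (sym (*-distribˡ-∑ (suc n) _ _)) (*-congˡ (predC-hockey-stick (suc n) (suc j)))) ⟩
      ∑[ j < n ] (invSuc j ^ m * β lam j) * ι (n C suc j) ∎
      where
      L = Li m (- lam) ∘S argS
      φ : ℕ → ℕ → Carrier
      φ j p = (invSuc j ^ m * β lam j) * ι (predC p (suc j))
      widen : ∀ {p} → p ≤ n → ∑[ j < n ] φ j p ≈ ∑[ j < p ] φ j p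
      widen p≤n = ∑-truncate _ p≤n (λ j p≤j _ → trans (*-congˡ (reflexive (≡.cong ι (predC-vanish p≤j)))) (zeroʳ _))

    K≈RHS : ∀ m lam n → K (suc m) lam n ≈ RHS (suc m) lam n
    K≈RHS m lam n = begin
      K (suc m) lam n                                                             ≈⟨ K-closed-form (suc m) lam n ⟩
      ∑[ j < n ] (invSuc j ^ suc m * β lam j) * ι (n C suc j)                     ≈⟨ ∑-cong n (λ j _ → trans (solve 3 (λ u b c → (u :* b) :* c := b :* (c :* u)) refl _ _ _) (*-congˡ (sym (harmonic-identity m n j)))) ⟩
      ∑[ j < n ] β lam j * (∑[ i < n ] w i j * H i)                               ≈⟨ ∑-cong n (λ j _ → *-distribˡ-∑ n (β lam j) _) ⟩
      ∑[ j < n ] ∑[ i < n ] β lam j * (w i j * H i)                               ≈⟨ ∑-comm n n _ ⟨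
      ∑[ i < n ] ∑[ j < n ] β lam j * (w i j * H i)                               ≈⟨ ∑-cong n (λ i _ → trans (∑-cong n (λ j _ → solve 4 (λ b c v h → b :* ((c :* v) :* h) := (c :* b) :* (v :* h)) refl _ _ _ _)) (sym (*-distribʳ-∑ n _ _))) ⟩
      ∑[ i < n ] (∑[ j < n ] ι (suc i C suc j) * β lam j) * (invSuc i * H i)      ≈⟨ ∑-cong n (λ i i<n → *-congʳ (signed-binom-expansion lam i<n)) ⟨
      ∑[ i < n ] (sign i * binom (lam - 1#) i) * (invSuc i * H i)                 ≈⟨ ∑-cong n (λ i _ → *-assoc _ _ _) ⟨
      ∑[ i < n ] (sign i * binom (lam - 1#) i * invSuc i) * H i                   ≈⟨ RHS-suc m lam n ⟨
      RHS (suc m) lam n                                                           ∎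
      where
      w : ℕ → ℕ → Carrier
      w i j = ι (suc i C suc j) * invSuc i
      H : ℕ → Carrier
      H i = harmonicTail m n (suc i)

theorem2p7 : ∀ {c ℓ₁ ℓ₂ : Level} (F : HeytingField c ℓ₁ ℓ₂)
               (char0 : WithField.CharZero F)
               (lam : HeytingField.Carrier F) → HeytingField._#_ F lam (HeytingField.0# F) →
               (n m : ℕ) → 1 ≤ n → 1 ≤ m →
               HeytingField._≈_ F
                 (WithField.WithCharZero.K F char0 m lam n)
                 (WithField.WithCharZero.RHS F char0 m lam n)
theorem2p7 F char0 lam _ n (suc m) _ _ = Polylogarithm.WithChar0.K≈RHS F char0 m lam n
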